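{- Let $H=(V,E)$ be a hypergraph and let $V_{odd}$ be the set of vertices of odd degree in $H$. (a) If $H$ is quasi-eulerian, then $$|E|\le \sum_{v\in V}\left\lfloor \frac{\deg_H(v)}{2}\right\rfloor \qquad\text{and}\qquad |V_{odd}|\le \sum_{e\in E}(|e|-2).$$ (b) Moreover, the two inequalities above are equivalent: the first holds if and only if the second holds.
   Context: A hypergraph $H=(V,E)$ has a nonempty finite vertex set $V$ and a finite set $E$ of edges, each edge being associated with a subset of $V$ (parallel edges allowed); all hypergraphs are assumed to have no empty edges. $\deg_H(v)$ is the number of edges containing $v$. A walk is a sequence $v_0e_1v_1\dots e_kv_k$ with $v_{i-1}\ne v_i$ and $v_{i-1},v_i\in e_i$ for all $i$; its anchors are $v_0,\dots,v_k$; it is closed if $k\ge2$ and $v_0=v_k$; it is a strict trail if $e_1,\dots,e_k$ are pairwise distinct. An Euler family of $H$ is a family of closed strict trails such that each edge of $H$ lies in exactly one trail of the family and the trails are pairwise anchor-disjoint. $H$ is quasi-eulerian if it admits an Euler family. -}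

module Defs where

open import Data.Nat using (ℕ; zero; suc; _+_; _≤_; _<_; _/_; _%_; _≟_)
open import Data.Integer as ℤ using (ℤ; +_; _-_)
open import Data.Fin using (Fin; zero; suc)
open import Data.Fin.Subset using (Subset; _∈_; ∣_∣; Nonempty)
open import Data.Fin.Subset.Properties using (_∈?_)
open import Data.Vec using (tabulate)
open import Data.List using (List; []; _∷_; map; length)
open import Data.List.Relation.Unary.Unique.Propositional using (Unique)
import Data.List.Membership.Propositional as L
open import Data.Product using (_×_; _,_; proj₁; proj₂; Σ; ∃)
open import Data.Unit using (⊤)
open import Relation.Nullary using (¬_; does)
open import Relation.Binary.PropositionalEquality using (_≡_; _≢_)

-- A hypergraph with vertex set Fin n (nonempty) and edges indexed by Fin m
-- (so parallel edges are allowed); each edge is a nonempty subset of Fin n.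
record Hypergraph (n m : ℕ) : Set where
  field
    vertices-nonempty : 0 < n
    edge              : Fin m → Subset n
    edge-nonempty     : ∀ e → Nonempty (edge e)

module _ {n m : ℕ} (H : Hypergraph n m) where
  open Hypergraph H

  deg : Fin n → ℕ
  deg v = ∣ tabulate (λ e → does (v ∈? edge e)) ∣

  Vodd : Subset n
  Vodd = tabulate (λ v → does (deg v % 2 ≟ 1))

  -- A walk v₀ e₁ v₁ … e_k v_k, given by its start vertex v₀ and
  -- the list of steps (e_i , v_i).
  record Walk : Set where
    constructor walk
    field
      start : Fin n
      steps : List (Fin m × Fin n)

  IsWalkFrom : Fin n → List (Fin m × Fin n) → Set
  IsWalkFrom u [] = ⊤
  IsWalkFrom u ((e , v) ∷ rest) = (u ≢ v) × (u ∈ edge e) × (v ∈ edge e) × IsWalkFrom v rest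

  endVertex : Fin n → List (Fin m × Fin n) → Fin n
  endVertex u [] = u
  endVertex u ((e , v) ∷ rest) = endVertex v rest

  IsWalk : Walk → Set
  IsWalk (walk s st) = IsWalkFrom s st

  edgesOf : Walk → List (Fin m)
  edgesOf (walk s st) = map proj₁ st

  anchors : Walk → List (Fin n)
  anchors (walk s st) = s ∷ map proj₂ st

  IsClosed : Walk → Set
  IsClosed (walk s st) = (2 ≤ length st) × (endVertex s st ≡ s)

  IsStrictTrail : Walk → Set
  IsStrictTrail w = IsWalk w × Unique (edgesOf w)

  IsClosedStrictTrail : Walk → Set
  IsClosedStrictTrail w = IsStrictTrail w × IsClosed w

  AnchorDisjoint : Walk → Walk → Set
  AnchorDisjoint w w' = ∀ x → x L.∈ anchors w → ¬ (x L.∈ anchors w')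

  record EulerFamily : Set where
    field
      t      : ℕ
      trail  : Fin t → Walk
      closed : ∀ i → IsClosedStrictTrail (trail i)
      cover  : ∀ e → Σ (Fin t) λ i → (e L.∈ edgesOf (trail i)) ×
                 (∀ j → e L.∈ edgesOf (trail j) → j ≡ i)
      disjoint : ∀ i j → i ≢ j → AnchorDisjoint (trail i) (trail j)

  QuasiEulerian : Set
  QuasiEulerian = EulerFamily

sumℕ : ∀ {k} → (Fin k → ℕ) → ℕ
sumℕ {zero} f = 0
sumℕ {suc k} f = f zero + sumℕ (λ i → f (suc i))

sumℤ : ∀ {k} → (Fin k → ℤ) → ℤ
sumℤ {zero} f = + 0
sumℤ {suc k} f = f zero ℤ.+ sumℤ (λ i → f (suc i))

module _ {n m : ℕ} (H : Hypergraph n m) where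
  open Hypergraph H

  Ineq1 : Set
  Ineq1 = m ≤ sumℕ (λ v → deg H v / 2)

  -- |V_odd| ≤ Σ_e (|e| - 2)   (in ℤ, since |e| - 2 may be negative)
  Ineq2 : Set
  Ineq2 = + ∣ Vodd H ∣ ℤ.≤ sumℤ (λ e → + ∣ edge e ∣ - + 2)

-- Double counting incidences and writing deg v = (deg v mod 2) + 2⌊deg v/2⌋ gives
-- Σₑ |e| = |V_odd| + 2 Σᵥ ⌊deg v/2⌋; subtracting 2|E| shows that the two inequalities
-- are equivalent.  For the first one, list all traversals u –e→ w of the trails of an
-- Euler family.  Every edge is traversed exactly once, and a traversal of e meets a
-- vertex v ∈ e at most once as its source or target (its ends differ), so the traversals
-- entering v plus those leaving v number at most deg v.  Closed walks leave each vertex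
-- as often as they enter it, so at most ⌊deg v/2⌋ traversals enter v; summing over v
-- bounds |E|.
module Submission where

open import Algebra.Bundles using (AbelianGroup)
open import Data.Bool using (Bool; true; false; if_then_else_)
open import Data.Empty using (⊥-elim)
open import Data.Fin as Fin using (Fin; zero; suc)
open import Data.Fin.Subset using (Subset; _∈_; ∣_∣; inside; outside)
open import Data.Fin.Subset.Properties using (_∈?_)
open import Data.Integer as ℤ using (+_; _-_)
import Data.Integer.Properties as ℤ
open import Data.Integer.Tactic.RingSolver using (solve-∀)
open import Data.List as List using (List; []; _∷_; _++_; map; length; concat)
import Data.List.Membership.Propositional as L
open import Data.List.Membership.Propositional.Properties using (∈-concat⁺′; ∈-tabulate⁺)
open import Data.List.Properties
  using (map-++; length-map; concat-map; map-tabulate; tabulate-cong)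
open import Data.List.Relation.Binary.Disjoint.Propositional using (Disjoint)
open import Data.List.Relation.Unary.All as All using (All; []; _∷_)
import Data.List.Relation.Unary.All.Properties as All
open import Data.List.Relation.Unary.AllPairs using ([]; _∷_)
import Data.List.Relation.Unary.AllPairs.Properties as AllPairs
open import Data.List.Relation.Unary.Any using (here; there)
open import Data.List.Relation.Unary.Unique.Propositional using (Unique)
import Data.List.Relation.Unary.Unique.Propositional.Properties as Unique
open import Data.Nat as ℕ using (ℕ; zero; suc; _+_; _*_; _≤_; _<_; _/_; _%_; z≤n; s≤s)
import Data.Nat.Properties as ℕ
open import Data.Nat.DivMod using (m≡m%n+[m/n]*n; m%n<n; m*n/n≡m; /-monoˡ-≤)
open import Data.Nat.ListAction using (sum)
open import Data.Product using (_×_; _,_; proj₁; proj₂)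
open import Data.Vec using ([]; _∷_; tabulate)
open import Function using (_∘_)
open import Function.Bundles using (_⇔_; mk⇔; Equivalence)
open import Function.Construct.Composition using (_⇔-∘_)
open import Function.Construct.Symmetry using (⇔-sym)
open import Relation.Binary.PropositionalEquality
open import Relation.Nullary using (does; yes; no)
open import Relation.Nullary.Decidable using (dec-true; dec-false)

open import Algebra.Properties.CommutativeSemigroup ℕ.+-commutativeSemigroup
  using (interchange; x∙yz≈y∙xz)
open import Algebra.Properties.Group (AbelianGroup.group ℤ.+-0-abelianGroup)
  using (//-rightDividesˡ; //-rightDividesʳ)
open import Defs

indicator : Bool → ℕ
indicator true  = 1
indicator false = 0

sumℕ-cong : ∀ {k} {f g : Fin k → ℕ} → (∀ i → f i ≡ g i) → sumℕ f ≡ sumℕ g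
sumℕ-cong {zero}  f≗g = refl
sumℕ-cong {suc k} f≗g = cong₂ _+_ (f≗g zero) (sumℕ-cong (f≗g ∘ suc))

sumℕ-mono-≤ : ∀ {k} {f g : Fin k → ℕ} → (∀ i → f i ≤ g i) → sumℕ f ≤ sumℕ g
sumℕ-mono-≤ {zero}  f≤g = z≤n
sumℕ-mono-≤ {suc k} f≤g = ℕ.+-mono-≤ (f≤g zero) (sumℕ-mono-≤ (f≤g ∘ suc))

sumℕ-zero : ∀ k → sumℕ {k} (λ _ → 0) ≡ 0
sumℕ-zero zero    = refl
sumℕ-zero (suc k) = sumℕ-zero k

sumℕ-one : ∀ k → sumℕ {k} (λ _ → 1) ≡ k
sumℕ-one zero    = refl
sumℕ-one (suc k) = cong suc (sumℕ-one k)

sumℕ-distrib-+ : ∀ {k} (f g : Fin k → ℕ) → sumℕ (λ i → f i + g i) ≡ sumℕ f + sumℕ g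
sumℕ-distrib-+ {zero}  f g = refl
sumℕ-distrib-+ {suc k} f g = begin
  f zero + g zero + sumℕ (λ i → f (suc i) + g (suc i))
    ≡⟨ cong (_+_ (f zero + g zero)) (sumℕ-distrib-+ (f ∘ suc) (g ∘ suc)) ⟩
  f zero + g zero + (sumℕ (f ∘ suc) + sumℕ (g ∘ suc))
    ≡⟨ interchange (f zero) (g zero) _ _ ⟩
  f zero + sumℕ (f ∘ suc) + (g zero + sumℕ (g ∘ suc)) ∎
  where open ≡-Reasoning

sumℕ-*ʳ : ∀ {k} c (f : Fin k → ℕ) → sumℕ (λ i → f i * c) ≡ sumℕ f * c
sumℕ-*ʳ {zero}  c f = refl
sumℕ-*ʳ {suc k} c f =
  trans (cong (_+_ (f zero * c)) (sumℕ-*ʳ c (f ∘ suc))) (sym (ℕ.*-distribʳ-+ c (f zero) _))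

sumℕ-comm : ∀ {a b} (f : Fin a → Fin b → ℕ) →
            sumℕ (λ i → sumℕ (f i)) ≡ sumℕ (λ j → sumℕ (λ i → f i j))
sumℕ-comm {zero}  {b} f = sym (sumℕ-zero b)
sumℕ-comm {suc a} {b} f = begin
  sumℕ (f zero) + sumℕ (λ i → sumℕ (f (suc i)))
    ≡⟨ cong (_+_ (sumℕ (f zero))) (sumℕ-comm (f ∘ suc)) ⟩
  sumℕ (f zero) + sumℕ (λ j → sumℕ (λ i → f (suc i) j))
    ≡⟨ sym (sumℕ-distrib-+ (f zero) (λ j → sumℕ (λ i → f (suc i) j))) ⟩
  sumℕ (λ j → f zero j + sumℕ (λ i → f (suc i) j)) ∎
  where open ≡-Reasoning

zeroAt : ∀ {k} → Fin k → (Fin k → ℕ) → Fin k → ℕ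
zeroAt j g i = if does (i Fin.≟ j) then 0 else g i

sumℕ-zeroAt : ∀ {k} (g : Fin k → ℕ) j → sumℕ g ≡ g j + sumℕ (zeroAt j g)
sumℕ-zeroAt {suc k} g zero    = refl
sumℕ-zeroAt {suc k} g (suc j) =
  trans (cong (_+_ (g zero)) (sumℕ-zeroAt (g ∘ suc) j)) (x∙yz≈y∙xz (g zero) (g (suc j)) _)

zeroAt-≢ : ∀ {k} (g : Fin k → ℕ) {i j : Fin k} → i ≢ j → zeroAt j g i ≡ g i
zeroAt-≢ g {i} {j} i≢j rewrite dec-false (i Fin.≟ j) i≢j = refl

-- Each term of the list is charged to the value of g at its key, which is then zeroed.
sum-map-≤-sumℕ : ∀ {A : Set} {k} (key : A → Fin k) (w : A → ℕ) (g : Fin k → ℕ) {xs} →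
                 Unique (map key xs) → All (λ x → w x ≤ g (key x)) xs →
                 sum (map w xs) ≤ sumℕ g
sum-map-≤-sumℕ key w g {[]}     _          _            = z≤n
sum-map-≤-sumℕ key w g {x ∷ xs} (x∉ ∷ uniq) (wx≤ ∷ ws≤) = begin
  w x + sum (map w xs)
    ≤⟨ ℕ.+-monoʳ-≤ (w x) (sum-map-≤-sumℕ key w _ uniq (bounds xs x∉ ws≤)) ⟩
  w x + sumℕ (zeroAt (key x) g)
    ≤⟨ ℕ.+-monoˡ-≤ _ wx≤ ⟩
  g (key x) + sumℕ (zeroAt (key x) g)
    ≡⟨ sumℕ-zeroAt g (key x) ⟨
  sumℕ g ∎
  where
  open ℕ.≤-Reasoning
  bounds : ∀ ys → All (key x ≢_) (map key ys) → All (λ y → w y ≤ g (key y)) ys →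
           All (λ y → w y ≤ zeroAt (key x) g (key y)) ys
  bounds []       []         []          = []
  bounds (y ∷ ys) (x≢y ∷ x∉) (wy≤ ∷ ws≤) =
    subst (w y ≤_) (sym (zeroAt-≢ g (x≢y ∘ sym))) wy≤ ∷ bounds ys x∉ ws≤

∣tabulate∣≡sumℕ : ∀ {k} (p : Fin k → Bool) → ∣ tabulate p ∣ ≡ sumℕ (indicator ∘ p)
∣tabulate∣≡sumℕ {zero}  p = refl
∣tabulate∣≡sumℕ {suc k} p with p zero
... | true  = cong suc (∣tabulate∣≡sumℕ (p ∘ suc))
... | false = ∣tabulate∣≡sumℕ (p ∘ suc)

∣s∣≡sumℕ : ∀ {k} (s : Subset k) → ∣ s ∣ ≡ sumℕ (λ i → indicator (does (i ∈? s)))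
∣s∣≡sumℕ []            = refl
∣s∣≡sumℕ (inside  ∷ s) = cong suc (∣s∣≡sumℕ s)
∣s∣≡sumℕ (outside ∷ s) = ∣s∣≡sumℕ s

m+m≤n⇒m≤n/2 : ∀ {m n} → m + m ≤ n → m ≤ n / 2
m+m≤n⇒m≤n/2 {m} {n} m+m≤n = begin
  m         ≡⟨ m*n/n≡m m 2 ⟨
  m * 2 / 2 ≤⟨ /-monoˡ-≤ 2 (subst (_≤ n) (ℕ.*-comm 2 m) (ℕ.≤-trans (ℕ.≤-reflexive 2m≡m+m) m+m≤n)) ⟩
  n / 2     ∎
  where
  open ℕ.≤-Reasoning
  2m≡m+m : 2 * m ≡ m + m
  2m≡m+m = cong (_+_ m) (ℕ.+-identityʳ m)

+a≤+b-+c⇔a+c≤b : ∀ a b c → (+ a ℤ.≤ + b - + c) ⇔ (a + c ≤ b)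
+a≤+b-+c⇔a+c≤b a b c = mk⇔ to from
  where
  open ℤ.≤-Reasoning
  to : + a ℤ.≤ + b - + c → a + c ≤ b
  to a≤b-c = ℤ.drop‿+≤+ (begin
    + (a + c)       ≡⟨ ℤ.pos-+ a c ⟩
    + a ℤ.+ + c     ≤⟨ ℤ.+-monoˡ-≤ (+ c) a≤b-c ⟩
    + b - + c ℤ.+ + c ≡⟨ //-rightDividesˡ (+ c) (+ b) ⟩
    + b             ∎)
  from : a + c ≤ b → + a ℤ.≤ + b - + c
  from a+c≤b = begin
    + a               ≡⟨ //-rightDividesʳ (+ c) (+ a) ⟨
    + a ℤ.+ + c - + c ≡⟨ cong (_- + c) (ℤ.pos-+ a c) ⟨
    + (a + c) - + c   ≤⟨ ℤ.+-monoˡ-≤ (ℤ.- + c) (ℤ.+≤+ a+c≤b) ⟩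
    + b - + c         ∎

sumℤ-+-minus : ∀ {k} c (f : Fin k → ℕ) → sumℤ (λ i → + f i - + c) ≡ + sumℕ f - + (k * c)
sumℤ-+-minus {zero}  c f = refl
sumℤ-+-minus {suc k} c f = begin
  + f zero - + c ℤ.+ sumℤ (λ i → + f (suc i) - + c)
    ≡⟨ cong (ℤ._+_ (+ f zero - + c)) (sumℤ-+-minus c (f ∘ suc)) ⟩
  + f zero - + c ℤ.+ (+ sumℕ (f ∘ suc) - + (k * c))
    ≡⟨ rearrange (+ f zero) (+ c) (+ sumℕ (f ∘ suc)) (+ (k * c)) ⟩
  (+ f zero ℤ.+ + sumℕ (f ∘ suc)) - (+ c ℤ.+ + (k * c))
    ≡⟨ cong₂ _-_ (ℤ.pos-+ (f zero) _) (ℤ.pos-+ c (k * c)) ⟨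
  + (f zero + sumℕ (f ∘ suc)) - + (c + k * c) ∎
  where
  open ≡-Reasoning
  rearrange : ∀ w x y z → w - x ℤ.+ (y - z) ≡ w ℤ.+ y - (x ℤ.+ z)
  rearrange = solve-∀

δ : ∀ {k} → Fin k → Fin k → ℕ
δ x y = indicator (does (x Fin.≟ y))

occurrences : ∀ {k} → Fin k → List (Fin k) → ℕ
occurrences x []       = 0
occurrences x (y ∷ ys) = δ x y + occurrences x ys

sumℕ-δ : ∀ {k} (y : Fin k) → sumℕ (λ x → δ x y) ≡ 1
sumℕ-δ {suc k} zero    = cong suc (sumℕ-zero k)
sumℕ-δ (suc y) = sumℕ-δ y

length≡sumℕ-occurrences : ∀ {k} (xs : List (Fin k)) →
                          length xs ≡ sumℕ (λ x → occurrences x xs)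
length≡sumℕ-occurrences {k} []       = sym (sumℕ-zero k)
length≡sumℕ-occurrences (y ∷ ys) = begin
  suc (length ys)
    ≡⟨ cong₂ _+_ (sym (sumℕ-δ y)) (length≡sumℕ-occurrences ys) ⟩
  sumℕ (λ x → δ x y) + sumℕ (λ x → occurrences x ys)
    ≡⟨ sym (sumℕ-distrib-+ (λ x → δ x y) (λ x → occurrences x ys)) ⟩
  sumℕ (λ x → occurrences x (y ∷ ys)) ∎
  where open ≡-Reasoning

∈⇒1≤occurrences : ∀ {k} {x : Fin k} {xs} → x L.∈ xs → 1 ≤ occurrences x xs
∈⇒1≤occurrences {x = x} (here refl) rewrite dec-true (x Fin.≟ x) refl = s≤s z≤n
∈⇒1≤occurrences {x = x} {y ∷ _} (there x∈) =
  ℕ.≤-trans (∈⇒1≤occurrences x∈) (ℕ.m≤n+m _ (δ x y))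

covering⇒k≤length : ∀ {k} {xs : List (Fin k)} → (∀ x → x L.∈ xs) → k ≤ length xs
covering⇒k≤length {k} {xs} covers = begin
  k                                  ≡⟨ sumℕ-one k ⟨
  sumℕ {k} (λ _ → 1)                 ≤⟨ sumℕ-mono-≤ (λ x → ∈⇒1≤occurrences (covers x)) ⟩
  sumℕ (λ x → occurrences x xs)      ≡⟨ length≡sumℕ-occurrences xs ⟨
  length xs                          ∎
  where open ℕ.≤-Reasoning

occurrences-map-++ : ∀ {A : Set} {k} (f : A → Fin k) x xs ys →
  occurrences x (map f (xs ++ ys)) ≡ occurrences x (map f xs) + occurrences x (map f ys)
occurrences-map-++ f x []       ys = refl
occurrences-map-++ f x (y ∷ xs) ys =
  trans (cong (_+_ (δ x (f y))) (occurrences-map-++ f x xs ys))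
        (sym (ℕ.+-assoc (δ x (f y)) _ _))

occurrences-map+occurrences-map : ∀ {A : Set} {k} (f g : A → Fin k) x xs →
  occurrences x (map f xs) + occurrences x (map g xs)
    ≡ sum (map (λ y → δ x (f y) + δ x (g y)) xs)
occurrences-map+occurrences-map f g x []       = refl
occurrences-map+occurrences-map f g x (y ∷ xs) =
  trans (interchange (δ x (f y)) _ (δ x (g y)) _)
        (cong (_+_ (δ x (f y) + δ x (g y))) (occurrences-map+occurrences-map f g x xs))

record Traversal (n m : ℕ) : Set where
  constructor _─[_]→_
  field
    source : Fin n
    via    : Fin m
    target : Fin n

open Traversal

module _ {n m : ℕ} where

  traversals : Fin n → List (Fin m × Fin n) → List (Traversal n m)
  traversals u []             = []
  traversals u ((e , v) ∷ st) = (u ─[ e ]→ v) ∷ traversals v st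

  map-via-traversals : ∀ u st → map via (traversals u st) ≡ map proj₁ st
  map-via-traversals u []             = refl
  map-via-traversals u ((e , v) ∷ st) = cong (e ∷_) (map-via-traversals v st)

  Balanced : List (Traversal n m) → Set
  Balanced ts = ∀ v → occurrences v (map source ts) ≡ occurrences v (map target ts)

  Balanced-++ : ∀ {ts ts′} → Balanced ts → Balanced ts′ → Balanced (ts ++ ts′)
  Balanced-++ {ts} {ts′} bal bal′ v = begin
    occurrences v (map source (ts ++ ts′))
      ≡⟨ occurrences-map-++ source v ts ts′ ⟩
    occurrences v (map source ts) + occurrences v (map source ts′)
      ≡⟨ cong₂ _+_ (bal v) (bal′ v) ⟩
    occurrences v (map target ts) + occurrences v (map target ts′)
      ≡⟨ occurrences-map-++ target v ts ts′ ⟨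
    occurrences v (map target (ts ++ ts′)) ∎
    where open ≡-Reasoning

  Balanced-concat : ∀ {tss} → All Balanced tss → Balanced (concat tss)
  Balanced-concat []            v = refl
  Balanced-concat {ts ∷ tss} (bal ∷ balss) =
    Balanced-++ {ts} {concat tss} bal (Balanced-concat balss)

module _ {n m : ℕ} (H : Hypergraph n m) where
  open Hypergraph H

  deg≡sumℕ : ∀ v → deg H v ≡ sumℕ (λ e → indicator (does (v ∈? edge e)))
  deg≡sumℕ v = ∣tabulate∣≡sumℕ (λ e → does (v ∈? edge e))

  sumℕ-∣edge∣≡sumℕ-deg : sumℕ (λ e → ∣ edge e ∣) ≡ sumℕ (deg H)
  sumℕ-∣edge∣≡sumℕ-deg = begin
    sumℕ (λ e → ∣ edge e ∣)                     ≡⟨ sumℕ-cong (λ e → ∣s∣≡sumℕ (edge e)) ⟩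
    sumℕ (λ e → sumℕ (λ v → incidence v e))     ≡⟨ sumℕ-comm (λ e v → incidence v e) ⟩
    sumℕ (λ v → sumℕ (λ e → incidence v e))     ≡⟨ sumℕ-cong (sym ∘ deg≡sumℕ) ⟩
    sumℕ (deg H)                                ∎
    where
    open ≡-Reasoning
    incidence : Fin n → Fin m → ℕ
    incidence v e = indicator (does (v ∈? edge e))

  ∣Vodd∣≡sumℕ-deg%2 : ∣ Vodd H ∣ ≡ sumℕ (λ v → deg H v % 2)
  ∣Vodd∣≡sumℕ-deg%2 = trans (∣tabulate∣≡sumℕ (λ v → does (deg H v % 2 ℕ.≟ 1)))
                             (sumℕ-cong (λ v → parity (m%n<n (deg H v) 2)))
    where
    parity : ∀ {r} → r < 2 → indicator (does (r ℕ.≟ 1)) ≡ r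
    parity {0} _ = refl
    parity {1} _ = refl
    parity {suc (suc _)} (s≤s (s≤s ()))

  sumℕ-∣edge∣≡∣Vodd∣+2sumℕ-deg/2 :
    sumℕ (λ e → ∣ edge e ∣) ≡ ∣ Vodd H ∣ + sumℕ (λ v → deg H v / 2) * 2
  sumℕ-∣edge∣≡∣Vodd∣+2sumℕ-deg/2 = begin
    sumℕ (λ e → ∣ edge e ∣)                          ≡⟨ sumℕ-∣edge∣≡sumℕ-deg ⟩
    sumℕ (deg H)
      ≡⟨ sumℕ-cong (λ v → m≡m%n+[m/n]*n (deg H v) 2) ⟩
    sumℕ (λ v → deg H v % 2 + deg H v / 2 * 2)
      ≡⟨ sumℕ-distrib-+ (λ v → deg H v % 2) (λ v → deg H v / 2 * 2) ⟩
    sumℕ (λ v → deg H v % 2) + sumℕ (λ v → deg H v / 2 * 2)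
      ≡⟨ cong₂ _+_ (sym ∣Vodd∣≡sumℕ-deg%2) (sumℕ-*ʳ 2 (λ v → deg H v / 2)) ⟩
    ∣ Vodd H ∣ + sumℕ (λ v → deg H v / 2) * 2        ∎
    where open ≡-Reasoning

  Ineq2⇔∣Vodd∣+2m≤sumℕ-∣edge∣ : Ineq2 H ⇔ (∣ Vodd H ∣ + m * 2 ≤ sumℕ (λ e → ∣ edge e ∣))
  Ineq2⇔∣Vodd∣+2m≤sumℕ-∣edge∣ =
    subst (λ z → (+ ∣ Vodd H ∣ ℤ.≤ z) ⇔ (∣ Vodd H ∣ + m * 2 ≤ sumℕ (λ e → ∣ edge e ∣)))
          (sym (sumℤ-+-minus 2 (λ e → ∣ edge e ∣)))
          (+a≤+b-+c⇔a+c≤b ∣ Vodd H ∣ (sumℕ (λ e → ∣ edge e ∣)) (m * 2))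

  Ineq1⇔Ineq2 : Ineq1 H ⇔ Ineq2 H
  Ineq1⇔Ineq2 = ⇔-sym Ineq2⇔∣Vodd∣+2m≤sumℕ-∣edge∣ ⇔-∘
    subst (λ z → Ineq1 H ⇔ (∣ Vodd H ∣ + m * 2 ≤ z)) (sym sumℕ-∣edge∣≡∣Vodd∣+2sumℕ-deg/2)
      (mk⇔ (λ m≤S → ℕ.+-monoʳ-≤ ∣ Vodd H ∣ (ℕ.*-monoˡ-≤ 2 m≤S))
           (λ ineq → ℕ.*-cancelʳ-≤ m _ 2 (ℕ.+-cancelˡ-≤ ∣ Vodd H ∣ _ _ ineq)))

  Proper : Traversal n m → Set
  Proper (u ─[ e ]→ v) = u ≢ v × u ∈ edge e × v ∈ edge e

  walk-traversals-proper : ∀ {u st} → IsWalkFrom H u st → All Proper (traversals u st)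
  walk-traversals-proper {st = []}          _                = []
  walk-traversals-proper {st = (e , v) ∷ st} (u≢v , u∈ , v∈ , rest) =
    (u≢v , u∈ , v∈) ∷ walk-traversals-proper rest

  -- Every anchor but the last is a source, every anchor but the first a target.
  occurrences-source+end : ∀ v u st →
    occurrences v (map source (traversals u st)) + δ v (endVertex H u st)
      ≡ occurrences v (map target (traversals u st)) + δ v u
  occurrences-source+end v u []             = refl
  occurrences-source+end v u ((e , w) ∷ st) = begin
    δ v u + occurrences v (map source ts) + δ v (endVertex H w st)
      ≡⟨ ℕ.+-assoc (δ v u) _ _ ⟩
    δ v u + (occurrences v (map source ts) + δ v (endVertex H w st))
      ≡⟨ cong (_+_ (δ v u)) (occurrences-source+end v w st) ⟩
    δ v u + (occurrences v (map target ts) + δ v w)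
      ≡⟨ ℕ.+-comm (δ v u) _ ⟩
    occurrences v (map target ts) + δ v w + δ v u
      ≡⟨ cong (_+ δ v u) (ℕ.+-comm _ (δ v w)) ⟩
    δ v w + occurrences v (map target ts) + δ v u ∎
    where
    open ≡-Reasoning
    ts = traversals w st

  closed-walk-balanced : ∀ u st → endVertex H u st ≡ u → Balanced (traversals u st)
  closed-walk-balanced u st end≡u v = ℕ.+-cancelʳ-≡ (δ v u) _ _
    (subst (λ z → _ + δ v z ≡ _) end≡u (occurrences-source+end v u st))

  proper-incidences : ∀ v {t} → Proper t →
                      δ v (target t) + δ v (source t) ≤ indicator (does (v ∈? edge (via t)))
  proper-incidences v {a ─[ e ]→ b} (a≢b , a∈ , b∈) with v Fin.≟ b | v Fin.≟ a
  ... | yes refl | yes refl = ⊥-elim (a≢b refl)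
  ... | yes refl | no _ rewrite dec-true (v ∈? edge e) b∈ = s≤s z≤n
  ... | no _     | yes refl rewrite dec-true (v ∈? edge e) a∈ = s≤s z≤n
  ... | no _     | no _ = z≤n

  target+source≤deg : ∀ {ts} → Unique (map via ts) → All Proper ts → ∀ v →
    occurrences v (map target ts) + occurrences v (map source ts) ≤ deg H v
  target+source≤deg {ts} uniq proper v = begin
    occurrences v (map target ts) + occurrences v (map source ts)
      ≡⟨ occurrences-map+occurrences-map target source v ts ⟩
    sum (map (λ t → δ v (target t) + δ v (source t)) ts)
      ≤⟨ sum-map-≤-sumℕ via _ _ uniq (All.map (proper-incidences v) proper) ⟩
    sumℕ (λ e → indicator (does (v ∈? edge e)))
      ≡⟨ deg≡sumℕ v ⟨
    deg H v ∎
    where open ℕ.≤-Reasoning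

  edge-traversals⇒Ineq1 : (ts : List (Traversal n m)) → All Proper ts → Balanced ts →
    Unique (map via ts) → (∀ e → e L.∈ map via ts) → Ineq1 H
  edge-traversals⇒Ineq1 ts proper bal uniq covers = begin
    m                                          ≤⟨ covering⇒k≤length covers ⟩
    length (map via ts)                        ≡⟨ length-map via ts ⟩
    length ts                                  ≡⟨ length-map target ts ⟨
    length (map target ts)                     ≡⟨ length≡sumℕ-occurrences (map target ts) ⟩
    sumℕ (λ v → occurrences v (map target ts)) ≤⟨ sumℕ-mono-≤ (m+m≤n⇒m≤n/2 ∘ twice≤deg) ⟩
    sumℕ (λ v → deg H v / 2)                   ∎
    where
    open ℕ.≤-Reasoning
    twice≤deg : ∀ v → occurrences v (map target ts) + occurrences v (map target ts) ≤ deg H v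
    twice≤deg v = subst (λ z → occurrences v (map target ts) + z ≤ deg H v) (bal v)
                        (target+source≤deg uniq proper v)

  quasiEulerian⇒Ineq1 : QuasiEulerian H → Ineq1 H
  quasiEulerian⇒Ineq1 F = edge-traversals⇒Ineq1 ts proper balanced unique covers
    where
    open EulerFamily F
    start : Fin t → Fin n
    start i = Walk.start (trail i)
    steps : Fin t → List (Fin m × Fin n)
    steps i = Walk.steps (trail i)
    trailTraversals : Fin t → List (Traversal n m)
    trailTraversals i = traversals (start i) (steps i)
    trailEdges : Fin t → List (Fin m)
    trailEdges i = edgesOf H (trail i)
    ts : List (Traversal n m)
    ts = concat (List.tabulate trailTraversals)

    map-via-ts : map via ts ≡ concat (List.tabulate trailEdges)
    map-via-ts = begin
      map via (concat (List.tabulate trailTraversals))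
        ≡⟨ concat-map (List.tabulate trailTraversals) ⟨
      concat (map (map via) (List.tabulate trailTraversals))
        ≡⟨ cong concat (map-tabulate trailTraversals (map via)) ⟩
      concat (List.tabulate (map via ∘ trailTraversals))
        ≡⟨ cong concat (tabulate-cong (λ i → map-via-traversals (start i) (steps i))) ⟩
      concat (List.tabulate trailEdges) ∎
      where open ≡-Reasoning

    trailEdges-disjoint : ∀ {i j} → i ≢ j → Disjoint (trailEdges i) (trailEdges j)
    trailEdges-disjoint {i} {j} i≢j {e} (e∈i , e∈j) =
      i≢j (trans (proj₂ (proj₂ (cover e)) i e∈i) (sym (proj₂ (proj₂ (cover e)) j e∈j)))

    proper : All Proper ts
    proper = All.concat⁺ (All.tabulate⁺ (walk-traversals-proper ∘ proj₁ ∘ proj₁ ∘ closed))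
    balanced : Balanced ts
    balanced = Balanced-concat {tss = List.tabulate trailTraversals}
      (All.tabulate⁺ (λ i → closed-walk-balanced (start i) (steps i) (proj₂ (proj₂ (closed i)))))
    unique : Unique (map via ts)
    unique = subst Unique (sym map-via-ts)
      (Unique.concat⁺ (All.tabulate⁺ (proj₂ ∘ proj₁ ∘ closed))
                      (AllPairs.tabulate⁺ trailEdges-disjoint))
    covers : ∀ e → e L.∈ map via ts
    covers e = subst (e L.∈_) (sym map-via-ts)
      (∈-concat⁺′ (proj₁ (proj₂ (cover e))) (∈-tabulate⁺ {f = trailEdges} (proj₁ (cover e))))

mainTheorem2 : ∀ {n m : ℕ} (H : Hypergraph n m) →
                 (QuasiEulerian H → Ineq1 H × Ineq2 H) × (Ineq1 H ⇔ Ineq2 H)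
mainTheorem2 H = both-inequalities , Ineq1⇔Ineq2 H
  where
  both-inequalities : QuasiEulerian H → Ineq1 H × Ineq2 H
  both-inequalities F = ineq1 , Equivalence.to (Ineq1⇔Ineq2 H) ineq1
    where ineq1 = quasiEulerian⇒Ineq1 H F
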